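{- Let $q=2$ (signature $(p,2)$). In $\mathcal P\otimes\bigwedge^\bullet(\mathfrak p^*)$ one has \[ \omega(L)\varphi_{KM}=-dd^c\varphi_0, \] where $\varphi_0=1$ is the constant polynomial (the Gaussian in the Fock model).
   Context: $\mathcal P=\mathbb C[z_1,\dots,z_{p+2}]$ (variables $z_\alpha$, $1\le\alpha\le p$, and $z_{p+1},z_{p+2}$); $\mathfrak p\cong M_{p,2}(\mathbb R)$ with basis $X_{\alpha\mu}$ and dual basis $\omega_{\alpha\mu}$ ($1\le\alpha\le p$, $\mu\in\{p+1,p+2\}$); work in $\mathcal P\otimes\bigwedge^\bullet(\mathfrak p^*)$ (infinitesimal Fock model of the Weil representation tensored with forms). Operators on $\mathcal P$: $\omega(X_{\alpha\mu})=-4\pi\frac{\partial^2}{\partial z_\alpha\partial z_\mu}+\frac1{4\pi}z_\alpha z_\mu$; $\omega(L)=2\pi\sum_{\alpha=1}^p\frac{\partial^2}{\partial z_\alpha^2}-\frac1{8\pi}(z_{p+1}^2+z_{p+2}^2)$ (acting on the polynomial factor). $\partial=\frac12\sum_\alpha\omega(X_{\alpha,p+1}-iX_{\alpha,p+2})\otimes(\omega_{\alpha,p+1}+i\omega_{\alpha,p+2})$ and $\bar\partial=\frac12\sum_\alpha\omega(X_{\alpha,p+1}+iX_{\alpha,p+2})\otimes(\omega_{\alpha,p+1}-i\omega_{\alpha,p+2})$, where $\omega(\cdot)$ is extended linearly and the form factor acts by left exterior multiplication; $d^c=\frac1{4\pi i}(\partial-\bar\partial)$ and $dd^c=-\frac1{2\pi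 i}\partial\bar\partial$. $\varphi_{KM}=\big(\frac{ -\sqrt2}{4\pi}\big)^2\sum_{\alpha_1,\alpha_2=1}^pz_{\alpha_1}z_{\alpha_2}\otimes\omega_{\alpha_1,p+1}\wedge\omega_{\alpha_2,p+2}$. -}

module Defs where

open import Algebra.Bundles using (CommutativeRing)
open import Data.Nat as ℕ using (ℕ; zero; suc)
open import Data.Fin using (Fin; zero; suc; _↑ˡ_; _↑ʳ_; combine)
open import Data.Vec using (Vec; []; _∷_; lookup; _[_]≔_)
open import Data.Bool using (Bool; true; false; if_then_else_; _∧_)
open import Function using (_∘_)

-- Infinitesimal Fock model of the Weil representation of signature (p,2),
-- tensored with forms on p ≅ M_{p,2}, with coefficients in a commutative
-- ring R (playing the role of ℂ) containing π, π⁻¹, ½, i, i⁻¹, √2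
-- (the relations they satisfy are hypotheses of the theorem).
--
-- An element of P ⊗ Λ(p*) is stored by its coefficients:
--   * a monomial z^e is indexed by an exponent vector e : Vec ℕ (p + 2)
--     (position α = z_α for α : Fin p, positions p, p+1 = z_{p+1}, z_{p+2});
--   * a basis form ω_{s₁} ∧ … ∧ ω_{s_k} (s₁ < … < s_k) is indexed by the
--     subset S : Vec Bool (p * 2) of generators; generator ω_{α,p+1+μ}
--     (μ : Fin 2) has index  combine α μ.
-- (Arbitrary coefficient functions = formal power series, which contain the
-- polynomials; all operators below are the standard ones.)

module Fock {c ℓ} (R : CommutativeRing c ℓ)
            (π π⁻¹ ½ i i⁻¹ √2 : CommutativeRing.Carrier R) (p : ℕ) where

  open CommutativeRing R using (Carrier; _≈_; _+_; _*_; -_; 0#; 1#)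

  Exp : Set
  Exp = Vec ℕ (p ℕ.+ 2)

  Frm : Set
  Frm = Vec Bool (p ℕ.* 2)

  Elt : Set c
  Elt = Exp → Frm → Carrier

  _≋_ : Elt → Elt → Set ℓ
  f ≋ g = ∀ e S → f e S ≈ g e S

  infix 4 _≋_
  infixl 6 _⊕_
  infixr 7 _⊙_

  _⊕_ : Elt → Elt → Elt
  (f ⊕ g) e S = f e S + g e S

  _⊙_ : Carrier → Elt → Elt
  (a ⊙ f) e S = a * f e S

  ⊝_ : Elt → Elt
  (⊝ f) e S = - f e S

  _⊖_ : Elt → Elt → Elt
  f ⊖ g = f ⊕ (⊝ g)

  zeroE : Elt
  zeroE e S = 0#

  sumElt : ∀ {n} → (Fin n → Elt) → Elt
  sumElt {zero}  F = zeroE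
  sumElt {suc n} F = F zero ⊕ sumElt (F ∘ suc)

  natR : ℕ → Carrier
  natR zero    = 0#
  natR (suc n) = 1# + natR n

  two four : Carrier
  two  = 1# + 1#
  four = two * two

  signR : ℕ → Carrier
  signR zero    = 1#
  signR (suc m) = - signR m

  zα : Fin p → Fin (p ℕ.+ 2)
  zα α = α ↑ˡ 2

  zμ : Fin 2 → Fin (p ℕ.+ 2)
  zμ μ = p ↑ʳ μ

  gen : Fin p → Fin 2 → Fin (p ℕ.* 2)
  gen α μ = combine α μ

  mulZ : Fin (p ℕ.+ 2) → Elt → Elt
  mulZ k f e S with lookup e k
  ... | zero  = 0#
  ... | suc m = f (e [ k ]≔ m) S

  derZ : Fin (p ℕ.+ 2) → Elt → Elt
  derZ k f e S = natR (suc (lookup e k)) * f (e [ k ]≔ suc (lookup e k)) S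

  countBelow : ∀ {n} → Vec Bool n → Fin n → ℕ
  countBelow (b ∷ S) zero    = 0
  countBelow (b ∷ S) (suc j) = (if b then 1 else 0) ℕ.+ countBelow S j

  wedge : Fin (p ℕ.* 2) → Elt → Elt
  wedge j f e S =
    if lookup S j then signR (countBelow S j) * f e (S [ j ]≔ false) else 0#

  ωX : Fin p → Fin 2 → Elt → Elt
  ωX α μ f = (- (four * π)) ⊙ derZ (zα α) (derZ (zμ μ) f)
           ⊕ (½ * ½ * π⁻¹) ⊙ mulZ (zα α) (mulZ (zμ μ) f)

  ωX⁻ ωX⁺ : Fin p → Elt → Elt
  ωX⁻ α f = ωX α zero f ⊕ (- i) ⊙ ωX α (suc zero) f
  ωX⁺ α f = ωX α zero f ⊕ i ⊙ ωX α (suc zero) f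

  ∂ : Elt → Elt
  ∂ f = ½ ⊙ sumElt (λ α → wedge (gen α zero) (ωX⁻ α f)
                         ⊕ i ⊙ wedge (gen α (suc zero)) (ωX⁻ α f))

  ∂̄ : Elt → Elt
  ∂̄ f = ½ ⊙ sumElt (λ α → wedge (gen α zero) (ωX⁺ α f)
                         ⊕ (- i) ⊙ wedge (gen α (suc zero)) (ωX⁺ α f))

  dc : Elt → Elt
  dc f = (½ * ½ * π⁻¹ * i⁻¹) ⊙ (∂ f ⊖ ∂̄ f)

  ddc : Elt → Elt
  ddc f = (- (½ * π⁻¹ * i⁻¹)) ⊙ ∂ (∂̄ f)

  ωL : Elt → Elt
  ωL f = (two * π) ⊙ sumElt (λ α → derZ (zα α) (derZ (zα α) f))
       ⊕ (- (½ * ½ * ½ * π⁻¹)) ⊙ ( mulZ (zμ zero) (mulZ (zμ zero) f)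
                                 ⊕ mulZ (zμ (suc zero)) (mulZ (zμ (suc zero)) f))

  allZero : ∀ {n} → Vec ℕ n → Bool
  allZero []          = true
  allZero (zero ∷ e)  = allZero e
  allZero (suc _ ∷ e) = false

  noneIn : ∀ {n} → Vec Bool n → Bool
  noneIn []          = true
  noneIn (true ∷ S)  = false
  noneIn (false ∷ S) = noneIn S

  φ₀ : Elt
  φ₀ e S = if allZero e ∧ noneIn S then 1# else 0#

  φKM : Elt
  φKM = (κ * κ) ⊙ sumElt (λ α₁ → sumElt (λ α₂ →
          mulZ (zα α₁) (mulZ (zα α₂)
            (wedge (gen α₁ zero) (wedge (gen α₂ (suc zero)) φ₀)))))
    where κ = - (√2 * (½ * ½ * π⁻¹))

{-# OPTIONS --safe #-}
-- Both sides reduce to the same explicit element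
--   (1/2π) Σ_a ω_{a,p+1} ∧ ω_{a,p+2} − (1/4π)³ Σ_{a,b} z_a z_b (z_{p+1}² + z_{p+2}²) ω_{a,p+1} ∧ ω_{b,p+2}.
-- On the left, the Laplacian part 2π Σ_γ ∂_γ² of ω(L) turns the z_a z_b of φ_KM into 2 δ_ab, and the
-- multiplication part gives the quartic term. On the right, all derivatives kill φ₀, so
-- ∂̄φ₀ = (1/8π) Σ_α (ω_{α,p+1} − i ω_{α,p+2}) z_α (z_{p+1} + i z_{p+2}), and ω(X_{β,p+1} − i X_{β,p+2}) sends
-- z_α (z_{p+1} + i z_{p+2}) to −8π δ_βα + (1/4π) z_β z_α (z_{p+1}² + z_{p+2}²), because
-- (∂_{p+1} − i ∂_{p+2})(z_{p+1} + i z_{p+2}) = 2 and (z_{p+1} − i z_{p+2})(z_{p+1} + i z_{p+2}) = z_{p+1}² + z_{p+2}².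
-- This coefficient is symmetric in (β, α), so once it is wedged with
-- (ω_{β,p+1} + i ω_{β,p+2}) ∧ (ω_{α,p+1} − i ω_{α,p+2}) and summed, the ω_{·,p+1} ∧ ω_{·,p+1} and
-- ω_{·,p+2} ∧ ω_{·,p+2} parts cancel by antisymmetry and the mixed parts add up to −2i ω_{a,p+1} ∧ ω_{b,p+2}.
module Submission where

open import Defs
open import Algebra.Bundles using (CommutativeRing)
open import Data.Nat as ℕ using (ℕ; zero; suc; s≤s)
open import Data.Nat.Properties using (+-suc; <⇒≤)
open import Data.Fin using (Fin; zero; suc; toℕ; splitAt)
open import Data.Fin.Properties using (_≟_; <-cmp; ↑ˡ-injective; ↑ʳ-injective; splitAt-↑ˡ; splitAt-↑ʳ)
open import Data.Bool using (Bool; true; false; if_then_else_)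
open import Data.Vec using (Vec; _∷_; lookup; _[_]≔_)
open import Data.Vec.Properties using (lookup∘update; lookup∘update′; []≔-commutes; []≔-idempotent; []≔-lookup)
open import Level using (_⊔_)
open import Data.Empty using (⊥-elim)
open import Function using (_∘_; Injective)
open import Relation.Binary using (Setoid; tri<; tri≈; tri>)
open import Relation.Binary.PropositionalEquality as ≡ using (_≡_; _≢_)
open import Relation.Nullary using (yes; no; does)
import Relation.Binary.Reasoning.Setoid as SetoidReasoning

module FockCalculus {c ℓ} (R : CommutativeRing c ℓ)
                    (π π⁻¹ ½ i i⁻¹ √2 : CommutativeRing.Carrier R) (p : ℕ) where

  open CommutativeRing R hiding (zero)
  open Fock R π π⁻¹ ½ i i⁻¹ √2 p
  open import Algebra.Properties.Ring ring
    using (-‿distribˡ-*; -‿distribʳ-*; -‿involutive; -0#≈0#; -‿+-comm)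
  open import Algebra.Properties.CommutativeSemigroup +-commutativeSemigroup
    using () renaming (interchange to +-interchange)
  open import Algebra.Properties.CommutativeSemigroup *-commutativeSemigroup
    using () renaming (x∙yz≈y∙xz to *-left-comm)
  open import Algebra.Solver.Ring.NaturalCoefficients.Default commutativeSemiring
    using (solve; _:+_; _:*_; _:=_; con)

  module ≈-Reasoning = SetoidReasoning setoid

  unit-cancelˡ : ∀ {u} → u ≈ 1# → ∀ x → u * x ≈ x
  unit-cancelˡ u≈1 x = trans (*-congʳ u≈1) (*-identityˡ x)

  -x*-y≈x*y : ∀ x y → (- x) * (- y) ≈ x * y
  -x*-y≈x*y x y =
    trans (sym (-‿distribˡ-* x (- y))) (trans (-‿cong (sym (-‿distribʳ-* x y))) (-‿involutive _))

  -- P ⊗ Λ(p*) as an R-module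

  ≋-setoid : Setoid c ℓ
  ≋-setoid = record
    { Carrier       = Elt
    ; _≈_           = _≋_
    ; isEquivalence = record
      { refl  = λ _ _ → refl
      ; sym   = λ f≋g e S → sym (f≋g e S)
      ; trans = λ f≋g g≋h e S → trans (f≋g e S) (g≋h e S)
      }
    }

  open Setoid ≋-setoid public using () renaming (refl to ≋-refl; sym to ≋-sym; trans to ≋-trans)
  module ≋-Reasoning = SetoidReasoning ≋-setoid

  ⊕-cong : ∀ {f f′ g g′} → f ≋ f′ → g ≋ g′ → f ⊕ g ≋ f′ ⊕ g′
  ⊕-cong f≋f′ g≋g′ e S = +-cong (f≋f′ e S) (g≋g′ e S)

  ⊙-congˡ : ∀ a {f g} → f ≋ g → a ⊙ f ≋ a ⊙ g
  ⊙-congˡ a f≋g e S = *-congˡ (f≋g e S)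

  ⊙-congʳ : ∀ {a b} → a ≈ b → ∀ f → a ⊙ f ≋ b ⊙ f
  ⊙-congʳ a≈b f e S = *-congʳ a≈b

  ⊙-merge : ∀ {a b c} → a * b ≈ c → ∀ f → a ⊙ (b ⊙ f) ≋ c ⊙ f
  ⊙-merge ab≈c f e S = trans (sym (*-assoc _ _ _)) (*-congʳ ab≈c)

  ⊝-cong : ∀ {f g} → f ≋ g → ⊝ f ≋ ⊝ g
  ⊝-cong f≋g e S = -‿cong (f≋g e S)

  ⊙-zeroˡ : ∀ f → 0# ⊙ f ≋ zeroE
  ⊙-zeroˡ f e S = zeroˡ (f e S)

  ⊙-zeroʳ : ∀ a → a ⊙ zeroE ≋ zeroE
  ⊙-zeroʳ a e S = zeroʳ a

  ⊕-identityˡ : ∀ f → zeroE ⊕ f ≋ f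
  ⊕-identityˡ f e S = +-identityˡ (f e S)

  ⊕-identityʳ : ∀ f → f ⊕ zeroE ≋ f
  ⊕-identityʳ f e S = +-identityʳ (f e S)

  sumElt-cong : ∀ {n} {F G : Fin n → Elt} → (∀ k → F k ≋ G k) → sumElt F ≋ sumElt G
  sumElt-cong {zero}  F≋G = ≋-refl
  sumElt-cong {suc n} F≋G = ⊕-cong (F≋G zero) (sumElt-cong (F≋G ∘ suc))

  sumElt-zero : ∀ {n} → sumElt {n} (λ _ → zeroE) ≋ zeroE
  sumElt-zero {zero}  = ≋-refl
  sumElt-zero {suc n} = ≋-trans (⊕-identityˡ _) (sumElt-zero {n})

  sumElt-⊕ : ∀ {n} (F G : Fin n → Elt) → sumElt (λ k → F k ⊕ G k) ≋ sumElt F ⊕ sumElt G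
  sumElt-⊕ {zero}  F G e S = sym (+-identityˡ 0#)
  sumElt-⊕ {suc n} F G e S =
    trans (+-congˡ (sumElt-⊕ (F ∘ suc) (G ∘ suc) e S)) (+-interchange _ _ _ _)

  sumElt-⊙ : ∀ {n} a (F : Fin n → Elt) → sumElt (λ k → a ⊙ F k) ≋ a ⊙ sumElt F
  sumElt-⊙ {zero}  a F e S = sym (zeroʳ a)
  sumElt-⊙ {suc n} a F e S = trans (+-congˡ (sumElt-⊙ a (F ∘ suc) e S)) (sym (distribˡ a _ _))

  sumElt-⊝ : ∀ {n} (F : Fin n → Elt) → sumElt (λ k → ⊝ F k) ≋ ⊝ sumElt F
  sumElt-⊝ {zero}  F e S = sym -0#≈0#
  sumElt-⊝ {suc n} F e S = trans (+-congˡ (sumElt-⊝ (F ∘ suc) e S)) (-‿+-comm _ _)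

  sumElt-⊕⊙ : ∀ {n} a (F G : Fin n → Elt) →
              sumElt (λ k → F k ⊕ a ⊙ G k) ≋ sumElt F ⊕ a ⊙ sumElt G
  sumElt-⊕⊙ a F G = ≋-trans (sumElt-⊕ F (λ k → a ⊙ G k)) (⊕-cong ≋-refl (sumElt-⊙ a G))

  sumElt-comm : ∀ {m n} (F : Fin m → Fin n → Elt) →
                sumElt (λ j → sumElt (λ k → F j k)) ≋ sumElt (λ k → sumElt (λ j → F j k))
  sumElt-comm {zero}  {n} F = ≋-sym (sumElt-zero {n})
  sumElt-comm {suc m}     F =
    ≋-trans (⊕-cong ≋-refl (sumElt-comm (F ∘ suc)))
            (≋-sym (sumElt-⊕ (F zero) (λ k → sumElt (λ j → F (suc j) k))))

  δ : ∀ {n} → Fin n → Fin n → Carrier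
  δ j k = if does (j ≟ k) then 1# else 0#

  δ-sym : ∀ {n} (j k : Fin n) → δ j k ≡ δ k j
  δ-sym j k with j ≟ k | k ≟ j
  ... | yes _   | yes _   = ≡.refl
  ... | no  _   | no  _   = ≡.refl
  ... | yes j≡k | no  k≢j = ⊥-elim (k≢j (≡.sym j≡k))
  ... | no  j≢k | yes k≡j = ⊥-elim (j≢k (≡.sym k≡j))

  δ-refl : ∀ {n} (k : Fin n) → δ k k ≡ 1#
  δ-refl k with k ≟ k
  ... | yes _   = ≡.refl
  ... | no  k≢k = ⊥-elim (k≢k ≡.refl)

  δ-≢ : ∀ {n} {j k : Fin n} → j ≢ k → δ j k ≡ 0#
  δ-≢ {j = j} {k} j≢k with j ≟ k
  ... | yes j≡k = ⊥-elim (j≢k j≡k)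
  ... | no  _   = ≡.refl

  δ-injective : ∀ {m n} {f : Fin m → Fin n} → Injective _≡_ _≡_ f → ∀ j k → δ (f j) (f k) ≡ δ j k
  δ-injective {f = f} f-inj j k with j ≟ k
  ... | yes ≡.refl = δ-refl (f j)
  ... | no  j≢k    = δ-≢ (j≢k ∘ f-inj)

  sumElt-δ : ∀ {n} (j : Fin n) (F : Fin n → Elt) → sumElt (λ k → δ k j ⊙ F k) ≋ F j
  sumElt-δ {suc n} zero    F e S =
    trans (+-cong (*-identityˡ _) (trans (sumElt-⊙ 0# (F ∘ suc) e S) (zeroˡ _))) (+-identityʳ _)
  sumElt-δ {suc n} (suc j) F e S =
    trans (+-cong (zeroˡ _) (sumElt-δ j (F ∘ suc) e S)) (+-identityˡ _)

  ΣΣ : (Fin p → Fin p → Elt) → Elt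
  ΣΣ F = sumElt (λ j → sumElt (λ k → F j k))

  ΣΣ-cong : ∀ {F G : Fin p → Fin p → Elt} → (∀ j k → F j k ≋ G j k) → ΣΣ F ≋ ΣΣ G
  ΣΣ-cong F≋G = sumElt-cong (λ j → sumElt-cong (F≋G j))

  ΣΣ-⊙ : ∀ a (F : Fin p → Fin p → Elt) → ΣΣ (λ j k → a ⊙ F j k) ≋ a ⊙ ΣΣ F
  ΣΣ-⊙ a F = ≋-trans (sumElt-cong (λ j → sumElt-⊙ a (F j))) (sumElt-⊙ a (λ j → sumElt (F j)))

  ΣΣ-⊕⊙ : ∀ a (F G : Fin p → Fin p → Elt) → ΣΣ (λ j k → F j k ⊕ a ⊙ G j k) ≋ ΣΣ F ⊕ a ⊙ ΣΣ G
  ΣΣ-⊕⊙ a F G = ≋-trans (sumElt-cong (λ j → sumElt-⊕⊙ a (F j) (G j)))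
                        (sumElt-⊕⊙ a (λ j → sumElt (F j)) (λ j → sumElt (G j)))

  ΣΣ-⊝ : ∀ (F : Fin p → Fin p → Elt) → ΣΣ (λ j k → ⊝ F j k) ≋ ⊝ ΣΣ F
  ΣΣ-⊝ F = ≋-trans (sumElt-cong (λ j → sumElt-⊝ (F j))) (sumElt-⊝ (λ j → sumElt (F j)))

  ΣΣ-transpose : ∀ (F : Fin p → Fin p → Elt) → ΣΣ F ≋ ΣΣ (λ j k → F k j)
  ΣΣ-transpose = sumElt-comm

  ΣΣ-δ : ∀ (F : Fin p → Fin p → Elt) → ΣΣ (λ j k → δ j k ⊙ F j k) ≋ sumElt (λ j → F j j)
  ΣΣ-δ F = sumElt-cong diagonal
    where
    diagonal : ∀ j → sumElt (λ k → δ j k ⊙ F j k) ≋ F j j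
    diagonal j = ≋-trans (sumElt-cong (λ k e S → *-congʳ (reflexive (δ-sym j k))))
                         (sumElt-δ j (F j))

  record IsLinear (T : Elt → Elt) : Set (c ⊔ ℓ) where
    field
      cong   : ∀ {f g} → f ≋ g → T f ≋ T g
      ⊕-homo : ∀ f g → T (f ⊕ g) ≋ T f ⊕ T g
      ⊙-homo : ∀ a f → T (a ⊙ f) ≋ a ⊙ T f

    zero-homo : T zeroE ≋ zeroE
    zero-homo = ≋-trans (cong (≋-sym (⊙-zeroˡ zeroE))) (≋-trans (⊙-homo 0# zeroE) (⊙-zeroˡ _))

    ⊕⊙-homo : ∀ a f g → T (f ⊕ a ⊙ g) ≋ T f ⊕ a ⊙ T g
    ⊕⊙-homo a f g = ≋-trans (⊕-homo f _) (⊕-cong ≋-refl (⊙-homo a g))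

    sumElt-homo : ∀ {n} (F : Fin n → Elt) → T (sumElt F) ≋ sumElt (T ∘ F)
    sumElt-homo {zero}  F = zero-homo
    sumElt-homo {suc n} F = ≋-trans (⊕-homo _ _) (⊕-cong ≋-refl (sumElt-homo (F ∘ suc)))

    ΣΣ-homo : ∀ (F : Fin p → Fin p → Elt) → T (ΣΣ F) ≋ ΣΣ (λ j k → T (F j k))
    ΣΣ-homo F = ≋-trans (sumElt-homo (λ j → sumElt (F j))) (sumElt-cong (λ j → sumElt-homo (F j)))

  ∘-linear : ∀ {T U} → IsLinear T → IsLinear U → IsLinear (T ∘ U)
  ∘-linear LT LU = record
    { cong   = T.cong ∘ U.cong
    ; ⊕-homo = λ f g → ≋-trans (T.cong (U.⊕-homo f g)) (T.⊕-homo _ _)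
    ; ⊙-homo = λ a f → ≋-trans (T.cong (U.⊙-homo a f)) (T.⊙-homo a _)
    }
    where
    module T = IsLinear LT
    module U = IsLinear LU

  ⊕-linear : ∀ {T U} → IsLinear T → IsLinear U → IsLinear (λ f → T f ⊕ U f)
  ⊕-linear LT LU = record
    { cong   = λ f≋g → ⊕-cong (T.cong f≋g) (U.cong f≋g)
    ; ⊕-homo = λ f g e S → trans (+-cong (T.⊕-homo f g e S) (U.⊕-homo f g e S)) (+-interchange _ _ _ _)
    ; ⊙-homo = λ a f e S → trans (+-cong (T.⊙-homo a f e S) (U.⊙-homo a f e S)) (sym (distribˡ a _ _))
    }
    where
    module T = IsLinear LT
    module U = IsLinear LU

  ⊙-linear : ∀ {T} a → IsLinear T → IsLinear (λ f → a ⊙ T f)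
  ⊙-linear a LT = record
    { cong   = ⊙-congˡ a ∘ T.cong
    ; ⊕-homo = λ f g e S → trans (*-congˡ (T.⊕-homo f g e S)) (distribˡ a _ _)
    ; ⊙-homo = λ b f e S → trans (*-congˡ (T.⊙-homo b f e S)) (*-left-comm a b _)
    }
    where
    module T = IsLinear LT

  sumElt-linear : ∀ {n} {T : Fin n → Elt → Elt} → (∀ k → IsLinear (T k)) →
                  IsLinear (λ f → sumElt (λ k → T k f))
  sumElt-linear {T = T} L = record
    { cong   = λ f≋g → sumElt-cong (λ k → IsLinear.cong (L k) f≋g)
    ; ⊕-homo = λ f g → ≋-trans (sumElt-cong (λ k → IsLinear.⊕-homo (L k) f g))
                               (sumElt-⊕ (λ k → T k f) (λ k → T k g))
    ; ⊙-homo = λ a f → ≋-trans (sumElt-cong (λ k → IsLinear.⊙-homo (L k) a f))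
                               (sumElt-⊙ a (λ k → T k f))
    }

  -- Multiplication, differentiation and exterior multiplication

  mulZ-at-suc : ∀ k f e S {m} → lookup e k ≡ suc m → mulZ k f e S ≈ f (e [ k ]≔ m) S
  mulZ-at-suc k f e S eq rewrite eq = refl

  mulZ-at-zero : ∀ k f e S → lookup e k ≡ zero → mulZ k f e S ≈ 0#
  mulZ-at-zero k f e S eq rewrite eq = refl

  mulZ-linear : ∀ k → IsLinear (mulZ k)
  mulZ-linear k = record { cong = cong′ ; ⊕-homo = ⊕-homo′ ; ⊙-homo = ⊙-homo′ }
    where
    cong′ : ∀ {f g} → f ≋ g → mulZ k f ≋ mulZ k g
    cong′ f≋g e S with lookup e k
    ... | zero  = refl
    ... | suc m = f≋g _ S
    ⊕-homo′ : ∀ f g → mulZ k (f ⊕ g) ≋ mulZ k f ⊕ mulZ k g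
    ⊕-homo′ f g e S with lookup e k
    ... | zero  = sym (+-identityˡ 0#)
    ... | suc m = refl
    ⊙-homo′ : ∀ a f → mulZ k (a ⊙ f) ≋ a ⊙ mulZ k f
    ⊙-homo′ a f e S with lookup e k
    ... | zero  = sym (zeroʳ a)
    ... | suc m = refl

  derZ-linear : ∀ k → IsLinear (derZ k)
  derZ-linear k = record
    { cong   = λ f≋g e S → *-congˡ (f≋g _ S)
    ; ⊕-homo = λ f g e S → distribˡ _ _ _
    ; ⊙-homo = λ a f e S → *-left-comm _ a _
    }

  wedge-linear : ∀ j → IsLinear (wedge j)
  wedge-linear j = record { cong = cong′ ; ⊕-homo = ⊕-homo′ ; ⊙-homo = ⊙-homo′ }
    where
    cong′ : ∀ {f g} → f ≋ g → wedge j f ≋ wedge j g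
    cong′ f≋g e S with lookup S j
    ... | true  = *-congˡ (f≋g e _)
    ... | false = refl
    ⊕-homo′ : ∀ f g → wedge j (f ⊕ g) ≋ wedge j f ⊕ wedge j g
    ⊕-homo′ f g e S with lookup S j
    ... | true  = distribˡ _ _ _
    ... | false = sym (+-identityˡ 0#)
    ⊙-homo′ : ∀ a f → wedge j (a ⊙ f) ≋ a ⊙ wedge j f
    ⊙-homo′ a f e S with lookup S j
    ... | true  = *-left-comm _ a _
    ... | false = sym (zeroʳ a)

  -- Operators A ⊗ 1, acting on the polynomial factor only.
  record IsPolynomialOperator (T : Elt → Elt) : Set (c ⊔ ℓ) where
    field
      linear     : IsLinear T
      wedge-comm : ∀ j f → T (wedge j f) ≋ wedge j (T f)

    open IsLinear linear public

  ∘-polynomial : ∀ {T U} → IsPolynomialOperator T → IsPolynomialOperator U →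
                 IsPolynomialOperator (T ∘ U)
  ∘-polynomial PT PU = record
    { linear     = ∘-linear T.linear U.linear
    ; wedge-comm = λ j f → ≋-trans (T.cong (U.wedge-comm j f)) (T.wedge-comm j _)
    }
    where
    module T = IsPolynomialOperator PT
    module U = IsPolynomialOperator PU

  ⊕-polynomial : ∀ {T U} → IsPolynomialOperator T → IsPolynomialOperator U →
                 IsPolynomialOperator (λ f → T f ⊕ U f)
  ⊕-polynomial {T} {U} PT PU = record
    { linear     = ⊕-linear PT.linear PU.linear
    ; wedge-comm = λ j f → ≋-trans (⊕-cong (PT.wedge-comm j f) (PU.wedge-comm j f))
                                   (≋-sym (IsLinear.⊕-homo (wedge-linear j) (T f) (U f)))
    }
    where
    module PT = IsPolynomialOperator PT
    module PU = IsPolynomialOperator PU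

  ⊙-polynomial : ∀ {T} a → IsPolynomialOperator T → IsPolynomialOperator (λ f → a ⊙ T f)
  ⊙-polynomial {T} a PT = record
    { linear     = ⊙-linear a PT.linear
    ; wedge-comm = λ j f → ≋-trans (⊙-congˡ a (PT.wedge-comm j f))
                                   (≋-sym (IsLinear.⊙-homo (wedge-linear j) a (T f)))
    }
    where
    module PT = IsPolynomialOperator PT

  mulZ-polynomial : ∀ k → IsPolynomialOperator (mulZ k)
  mulZ-polynomial k = record { linear = mulZ-linear k ; wedge-comm = comm }
    where
    comm : ∀ j f → mulZ k (wedge j f) ≋ wedge j (mulZ k f)
    comm j f e S with lookup e k
    ... | suc m = refl
    ... | zero with lookup S j
    ...   | true  = sym (zeroʳ _)
    ...   | false = refl

  derZ-polynomial : ∀ k → IsPolynomialOperator (derZ k)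
  derZ-polynomial k = record { linear = derZ-linear k ; wedge-comm = comm }
    where
    comm : ∀ j f → derZ k (wedge j f) ≋ wedge j (derZ k f)
    comm j f e S with lookup S j
    ... | true  = *-left-comm _ _ _
    ... | false = zeroʳ _

  exponent-cong : ∀ (f : Elt) {e e′} S → e ≡ e′ → f e S ≈ f e′ S
  exponent-cong f S ≡.refl = refl

  mulZ-comm : ∀ j k f → mulZ j (mulZ k f) ≋ mulZ k (mulZ j f)
  mulZ-comm j k f e S with j ≟ k
  ... | yes ≡.refl = refl
  ... | no j≢k with lookup e j in ej | lookup e k in ek
  ...   | zero  | zero  = refl
  ...   | zero  | suc b = sym (mulZ-at-zero j f (e [ k ]≔ b) S (≡.trans (lookup∘update′ j≢k e b) ej))
  ...   | suc a | zero  = mulZ-at-zero k f (e [ j ]≔ a) S (≡.trans (lookup∘update′ (j≢k ∘ ≡.sym) e a) ek)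
  ...   | suc a | suc b =
    trans (mulZ-at-suc k f (e [ j ]≔ a) S (≡.trans (lookup∘update′ (j≢k ∘ ≡.sym) e a) ek))
    (trans (exponent-cong f S ([]≔-commutes e j k j≢k))
           (sym (mulZ-at-suc j f (e [ k ]≔ b) S (≡.trans (lookup∘update′ j≢k e b) ej))))

  []≔-lookup′ : ∀ {A : Set} {n} (e : Vec A n) k {x} → lookup e k ≡ x → e [ k ]≔ x ≡ e
  []≔-lookup′ e k eq = ≡.trans (≡.cong (e [ k ]≔_) (≡.sym eq)) ([]≔-lookup e k)

  mulZ-at-raised : ∀ k f e m S → mulZ k f (e [ k ]≔ suc m) S ≈ f (e [ k ]≔ m) S
  mulZ-at-raised k f e m S =
    trans (mulZ-at-suc k f _ S (lookup∘update k e (suc m))) (exponent-cong f S ([]≔-idempotent e k))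

  derZ-at-updated : ∀ k f e m S → derZ k f (e [ k ]≔ m) S ≈ natR (suc m) * f (e [ k ]≔ suc m) S
  derZ-at-updated k f e m S rewrite lookup∘update k e m = *-congˡ (exponent-cong f S ([]≔-idempotent e k))

  derZ-mulZ-same : ∀ k f → derZ k (mulZ k f) ≋ f ⊕ mulZ k (derZ k f)
  derZ-mulZ-same k f e S with lookup e k in ek
  ... | zero  =
    trans (*-cong (+-identityʳ 1#)
                  (trans (mulZ-at-raised k f e 0 S) (exponent-cong f S ([]≔-lookup′ e k ek))))
          (trans (*-identityˡ _) (sym (+-identityʳ _)))
  ... | suc m =
    trans (*-congˡ (trans (mulZ-at-raised k f e (suc m) S) (exponent-cong f S ([]≔-lookup′ e k ek))))
    (trans (trans (distribʳ _ 1# _) (+-congʳ (*-identityˡ _)))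
           (+-congˡ (sym (trans (derZ-at-updated k f e m S)
                                (*-congˡ (exponent-cong f S ([]≔-lookup′ e k ek)))))))

  derZ-mulZ-≢ : ∀ {j k} → j ≢ k → ∀ f → derZ j (mulZ k f) ≋ mulZ k (derZ j f)
  derZ-mulZ-≢ {j} {k} j≢k f e S with lookup e k in ek
  ... | zero  = trans (*-congˡ (mulZ-at-zero k f (e [ j ]≔ suc (lookup e j)) S
                                 (≡.trans (lookup∘update′ (j≢k ∘ ≡.sym) e _) ek)))
                      (zeroʳ _)
  ... | suc m =
    trans (*-congˡ (mulZ-at-suc k f (e [ j ]≔ suc (lookup e j)) S
                     (≡.trans (lookup∘update′ (j≢k ∘ ≡.sym) e _) ek)))
    (trans (*-congˡ (exponent-cong f S (≡.sym ([]≔-commutes e k j (j≢k ∘ ≡.sym)))))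
           (reflexive (≡.cong (λ x → natR (suc x) * f ((e [ k ]≔ m) [ j ]≔ suc x) S)
                              (≡.sym (lookup∘update′ j≢k e m)))))

  derZ-mulZ : ∀ j k f → derZ j (mulZ k f) ≋ δ j k ⊙ f ⊕ mulZ k (derZ j f)
  derZ-mulZ j k f e S with j ≟ k
  ... | yes ≡.refl = trans (derZ-mulZ-same j f e S) (+-congʳ (sym (*-identityˡ _)))
  ... | no  j≢k    = trans (derZ-mulZ-≢ j≢k f e S) (sym (trans (+-congʳ (zeroˡ _)) (+-identityˡ _)))

  allZero-raised : ∀ {n} (e : Vec ℕ n) k m → allZero (e [ k ]≔ suc m) ≡ false
  allZero-raised (x ∷ e)     zero    m = ≡.refl
  allZero-raised (zero ∷ e)  (suc k) m = allZero-raised e k m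
  allZero-raised (suc x ∷ e) (suc k) m = ≡.refl

  derZ-φ₀ : ∀ k → derZ k φ₀ ≋ zeroE
  derZ-φ₀ k e S rewrite allZero-raised e k (lookup e k) = zeroʳ _

  derZ-mulZ-vacuum : ∀ j k {V} → derZ j V ≋ zeroE → derZ j (mulZ k V) ≋ δ j k ⊙ V
  derZ-mulZ-vacuum j k {V} ∂V≋0 =
    ≋-trans (derZ-mulZ j k V)
            (≋-trans (⊕-cong ≋-refl (≋-trans (IsLinear.cong (mulZ-linear k) ∂V≋0)
                                             (IsLinear.zero-homo (mulZ-linear k))))
                     (⊕-identityʳ _))

  countBelow-update-above : ∀ {n} (S : Vec Bool n) (j k : Fin n) b → toℕ k ℕ.≤ toℕ j →
                            countBelow (S [ j ]≔ b) k ≡ countBelow S k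
  countBelow-update-above (x ∷ S) zero    zero    b _         = ≡.refl
  countBelow-update-above (x ∷ S) (suc j) zero    b _         = ≡.refl
  countBelow-update-above (x ∷ S) (suc j) (suc k) b (s≤s k≤j) =
    ≡.cong (_ ℕ.+_) (countBelow-update-above S j k b k≤j)

  countBelow-remove-below : ∀ {n} (S : Vec Bool n) (j k : Fin n) → lookup S j ≡ true →
                            toℕ j ℕ.< toℕ k → suc (countBelow (S [ j ]≔ false) k) ≡ countBelow S k
  countBelow-remove-below (x ∷ S) zero    (suc k) ≡.refl _         = ≡.refl
  countBelow-remove-below (x ∷ S) (suc j) (suc k) Sj      (s≤s j<k) =
    ≡.trans (≡.sym (+-suc _ _)) (≡.cong (_ ℕ.+_) (countBelow-remove-below S j k Sj j<k))

  wedge-nilpotent : ∀ j f → wedge j (wedge j f) ≋ zeroE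
  wedge-nilpotent j f e S with lookup S j
  ... | false = refl
  ... | true rewrite lookup∘update j S false = zeroʳ _

  wedge-anticomm : ∀ j k f → wedge j (wedge k f) ≋ ⊝ wedge k (wedge j f)
  wedge-anticomm j k f e S with j ≟ k
  ... | yes ≡.refl = trans (wedge-nilpotent j f e S)
                           (sym (trans (-‿cong (wedge-nilpotent j f e S)) -0#≈0#))
  ... | no j≢k
    rewrite lookup∘update′ (j≢k ∘ ≡.sym) S false
          | lookup∘update′ j≢k S false
          | []≔-commutes {x = false} {y = false} S j k j≢k
    with lookup S j in Sj | lookup S k in Sk
  ...   | false | false = sym -0#≈0#
  ...   | false | true  = sym (trans (-‿cong (zeroʳ _)) -0#≈0#)
  ...   | true  | false = trans (zeroʳ _) (sym -0#≈0#)
  ...   | true  | true with <-cmp j k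
  ...     | tri< j<k _ _
    rewrite ≡.sym (countBelow-remove-below S j k Sj j<k)
          | countBelow-update-above S k j false (<⇒≤ j<k)
          = trans (*-left-comm _ _ _) (trans (sym (-‿involutive _)) (-‿cong (-‿distribˡ-* _ _)))
  ...     | tri≈ _ j≡k _ = ⊥-elim (j≢k j≡k)
  ...     | tri> _ _ k<j
    rewrite ≡.sym (countBelow-remove-below S k j Sk k<j)
          | countBelow-update-above S j k false (<⇒≤ k<j)
          = trans (sym (-‿distribˡ-* _ _)) (-‿cong (*-left-comm _ _ _))

  z₁ z₂ : Fin (p ℕ.+ 2)
  z₁ = zμ zero
  z₂ = zμ (suc zero)

  zα-injective : Injective _≡_ _≡_ zα
  zα-injective {a} {b} = ↑ˡ-injective 2 a b

  zα≢zμ : ∀ α μ → zα α ≢ zμ μ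
  zα≢zμ α μ eq with ≡.trans (≡.sym (splitAt-↑ˡ p α 2))
                             (≡.trans (≡.cong (splitAt p) eq) (splitAt-↑ʳ p 2 μ))
  ... | ()

  z₁≢z₂ : z₁ ≢ z₂
  z₁≢z₂ eq with ↑ʳ-injective p zero (suc zero) eq
  ... | ()

  -- In this notation ∂ f, ∂̄ f and ωL f unfold definitionally to ½ ⊙ Σ_α Θ i α (ωX⁻ α f),
  -- ½ ⊙ Σ_α Θ (- i) α (ωX⁺ α f) and (2π) ⊙ Δ f ⊕ (−1/8π) ⊙ mulQ f.
  ω₁∧ω₂ : Fin p → Fin p → Elt → Elt
  ω₁∧ω₂ a b f = wedge (gen a zero) (wedge (gen b (suc zero)) f)

  Θ : Carrier → Fin p → Elt → Elt
  Θ t α f = wedge (gen α zero) f ⊕ t ⊙ wedge (gen α (suc zero)) f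

  mulW derW : Carrier → Elt → Elt
  mulW t f = mulZ z₁ f ⊕ t ⊙ mulZ z₂ f
  derW t f = derZ z₁ f ⊕ t ⊙ derZ z₂ f

  mulQ : Elt → Elt
  mulQ f = mulZ z₁ (mulZ z₁ f) ⊕ mulZ z₂ (mulZ z₂ f)

  Δ : Elt → Elt
  Δ f = sumElt (λ γ → derZ (zα γ) (derZ (zα γ) f))

  Θ-linear : ∀ t α → IsLinear (Θ t α)
  Θ-linear t α = ⊕-linear (wedge-linear _) (⊙-linear t (wedge-linear _))

  ω₁∧ω₂-linear : ∀ a b → IsLinear (ω₁∧ω₂ a b)
  ω₁∧ω₂-linear a b = ∘-linear (wedge-linear _) (wedge-linear _)

  Δ-linear : IsLinear Δ
  Δ-linear = sumElt-linear (λ γ → ∘-linear (derZ-linear (zα γ)) (derZ-linear (zα γ)))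

  ωX-polynomial : ∀ α μ → IsPolynomialOperator (ωX α μ)
  ωX-polynomial α μ =
    ⊕-polynomial (⊙-polynomial _ (∘-polynomial (derZ-polynomial _) (derZ-polynomial _)))
                 (⊙-polynomial _ (∘-polynomial (mulZ-polynomial _) (mulZ-polynomial _)))

  ωX⁻-polynomial : ∀ α → IsPolynomialOperator (ωX⁻ α)
  ωX⁻-polynomial α = ⊕-polynomial (ωX-polynomial α zero) (⊙-polynomial _ (ωX-polynomial α (suc zero)))

  mulQ-polynomial : IsPolynomialOperator mulQ
  mulQ-polynomial = ⊕-polynomial (∘-polynomial (mulZ-polynomial z₁) (mulZ-polynomial z₁))
                                 (∘-polynomial (mulZ-polynomial z₂) (mulZ-polynomial z₂))

  module _ {T} (PT : IsPolynomialOperator T) where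
    open IsPolynomialOperator PT

    polynomial-Θ-comm : ∀ t α f → T (Θ t α f) ≋ Θ t α (T f)
    polynomial-Θ-comm t α f =
      ≋-trans (⊕⊙-homo t _ _) (⊕-cong (wedge-comm _ f) (⊙-congˡ t (wedge-comm _ f)))

    polynomial-ω₁∧ω₂-comm : ∀ a b f → T (ω₁∧ω₂ a b f) ≋ ω₁∧ω₂ a b (T f)
    polynomial-ω₁∧ω₂-comm a b f =
      ≋-trans (wedge-comm _ _) (IsLinear.cong (wedge-linear _) (wedge-comm _ f))

  mulQ-mulZ : ∀ k f → mulQ (mulZ k f) ≋ mulZ k (mulQ f)
  mulQ-mulZ k f = ≋-trans (⊕-cong (past z₁) (past z₂)) (≋-sym (IsLinear.⊕-homo (mulZ-linear k) _ _))
    where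
    past : ∀ j → mulZ j (mulZ j (mulZ k f)) ≋ mulZ k (mulZ j (mulZ j f))
    past j = ≋-trans (IsLinear.cong (mulZ-linear j) (mulZ-comm j k f)) (mulZ-comm j k _)

  ωX-combination : ∀ t α f →
    ωX α zero f ⊕ t ⊙ ωX α (suc zero) f ≋
    (- (four * π)) ⊙ derZ (zα α) (derW t f) ⊕ (½ * ½ * π⁻¹) ⊙ mulZ (zα α) (mulW t f)
  ωX-combination t α f e S =
    trans (regroup (- (four * π)) (½ * ½ * π⁻¹) t _ _ _ _)
          (sym (+-cong (*-congˡ (IsLinear.⊕⊙-homo (derZ-linear (zα α)) t (derZ z₁ f) (derZ z₂ f) e S))
                       (*-congˡ (IsLinear.⊕⊙-homo (mulZ-linear (zα α)) t (mulZ z₁ f) (mulZ z₂ f) e S))))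
    where
    regroup : ∀ m c t a a′ b b′ →
              (m * a + c * b) + t * (m * a′ + c * b′) ≈ m * (a + t * a′) + c * (b + t * b′)
    regroup = solve 7 (λ m c t a a′ b b′ →
                (m :* a :+ c :* b) :+ t :* (m :* a′ :+ c :* b′) :=
                m :* (a :+ t :* a′) :+ c :* (b :+ t :* b′)) refl

  derW-φ₀ : ∀ t → derW t φ₀ ≋ zeroE
  derW-φ₀ t e S = trans (+-cong (derZ-φ₀ z₁ e S) (trans (*-congˡ (derZ-φ₀ z₂ e S)) (zeroʳ t)))
                        (+-identityˡ 0#)

  derW-mulZ-zα : ∀ t α f → derW t (mulZ (zα α) f) ≋ mulZ (zα α) (derW t f)
  derW-mulZ-zα t α f =
    ≋-trans (⊕-cong (derZ-mulZ-≢ (zα≢zμ α zero ∘ ≡.sym) f)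
                    (⊙-congˡ t (derZ-mulZ-≢ (zα≢zμ α (suc zero) ∘ ≡.sym) f)))
            (≋-sym (IsLinear.⊕⊙-homo (mulZ-linear (zα α)) t _ _))

  mulW-mulZ : ∀ t k f → mulW t (mulZ k f) ≋ mulZ k (mulW t f)
  mulW-mulZ t k f =
    ≋-trans (⊕-cong (mulZ-comm z₁ k f) (⊙-congˡ t (mulZ-comm z₂ k f)))
            (≋-sym (IsLinear.⊕⊙-homo (mulZ-linear k) t _ _))

  derW-mulW-φ₀ : ∀ t t′ → derW t (mulW t′ φ₀) ≋ (1# + t * t′) ⊙ φ₀
  derW-mulW-φ₀ t t′ e S = begin
    derW t (mulW t′ φ₀) e S
      ≈⟨ +-cong (expand z₁) (*-congˡ (expand z₂)) ⟩
    (d z₁ z₁ + t′ * d z₁ z₂) + t * (d z₂ z₁ + t′ * d z₂ z₂)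
      ≈⟨ +-cong (+-cong (same z₁) (*-congˡ (other z₁≢z₂)))
                (*-congˡ (+-cong (other (z₁≢z₂ ∘ ≡.sym)) (*-congˡ (same z₂)))) ⟩
    (x + t′ * 0#) + t * (0# + t′ * x)
      ≈⟨ solve 3 (λ t t′ x → (x :+ t′ :* con 0) :+ t :* (con 0 :+ t′ :* x)
                             := (con 1 :+ t :* t′) :* x) refl t t′ x ⟩
    (1# + t * t′) * x ∎
    where
    open ≈-Reasoning
    x : Carrier
    x = φ₀ e S
    d : Fin (p ℕ.+ 2) → Fin (p ℕ.+ 2) → Carrier
    d j k = derZ j (mulZ k φ₀) e S
    expand : ∀ j → derZ j (mulW t′ φ₀) e S ≈ d j z₁ + t′ * d j z₂
    expand j = IsLinear.⊕⊙-homo (derZ-linear j) t′ (mulZ z₁ φ₀) (mulZ z₂ φ₀) e S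
    same : ∀ j → d j j ≈ x
    same j = trans (derZ-mulZ-vacuum j j (derZ-φ₀ j) e S)
                   (trans (*-congʳ (reflexive (δ-refl j))) (*-identityˡ x))
    other : ∀ {j k} → j ≢ k → d j k ≈ 0#
    other {j} {k} j≢k = trans (derZ-mulZ-vacuum j k (derZ-φ₀ j) e S)
                              (trans (*-congʳ (reflexive (δ-≢ j≢k))) (zeroˡ x))

  mulW-mulW : ∀ {t t′} → t + t′ ≈ 0# → t * t′ ≈ 1# → ∀ f → mulW t (mulW t′ f) ≋ mulQ f
  mulW-mulW {t} {t′} t+t′≈0 tt′≈1 f e S = begin
    mulW t (mulW t′ f) e S
      ≈⟨ +-cong (expand z₁) (*-congˡ (expand z₂)) ⟩
    (z z₁ z₁ + t′ * z z₁ z₂) + t * (z z₂ z₁ + t′ * z z₂ z₂)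
      ≈⟨ +-congˡ (*-congˡ (+-congʳ (mulZ-comm z₂ z₁ f e S))) ⟩
    (z z₁ z₁ + t′ * z z₁ z₂) + t * (z z₁ z₂ + t′ * z z₂ z₂)
      ≈⟨ solve 5 (λ t t′ a b c → (a :+ t′ :* b) :+ t :* (b :+ t′ :* c)
                                 := a :+ ((t :+ t′) :* b :+ (t :* t′) :* c)) refl t t′ _ _ _ ⟩
    z z₁ z₁ + ((t + t′) * z z₁ z₂ + (t * t′) * z z₂ z₂)
      ≈⟨ +-congˡ (+-cong (*-congʳ t+t′≈0) (*-congʳ tt′≈1)) ⟩
    z z₁ z₁ + (0# * z z₁ z₂ + 1# * z z₂ z₂)
      ≈⟨ +-congˡ (trans (+-cong (zeroˡ _) (*-identityˡ _)) (+-identityˡ _)) ⟩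
    z z₁ z₁ + z z₂ z₂ ∎
    where
    open ≈-Reasoning
    z : Fin (p ℕ.+ 2) → Fin (p ℕ.+ 2) → Carrier
    z j k = mulZ j (mulZ k f) e S
    expand : ∀ j → mulZ j (mulW t′ f) e S ≈ z j z₁ + t′ * z j z₂
    expand j = IsLinear.⊕⊙-homo (mulZ-linear j) t′ (mulZ z₁ f) (mulZ z₂ f) e S

  derZ-mulZ-α : ∀ γ k f → derZ (zα γ) (mulZ (zα k) f) ≋ δ γ k ⊙ f ⊕ mulZ (zα k) (derZ (zα γ) f)
  derZ-mulZ-α γ k f e S =
    trans (derZ-mulZ (zα γ) (zα k) f e S) (+-congʳ (*-congʳ (reflexive (δ-injective zα-injective γ k))))

  derZ-mulZ-α-vacuum : ∀ γ k {V} → derZ (zα γ) V ≋ zeroE → derZ (zα γ) (mulZ (zα k) V) ≋ δ γ k ⊙ V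
  derZ-mulZ-α-vacuum γ k {V} ∂V≋0 e S =
    trans (derZ-mulZ-vacuum (zα γ) (zα k) ∂V≋0 e S) (*-congʳ (reflexive (δ-injective zα-injective γ k)))

  Δ-quadratic : ∀ a b {V} → (∀ γ → derZ (zα γ) V ≋ zeroE) →
                Δ (mulZ (zα a) (mulZ (zα b) V)) ≋ δ a b ⊙ (two ⊙ V)
  Δ-quadratic a b {V} ∂V≋0 =
    ≋-trans (sumElt-cong second-derivative) (sumElt-δ a (λ γ → δ γ b ⊙ (two ⊙ V)))
    where
    open ≋-Reasoning
    first : ∀ γ k → derZ (zα γ) (mulZ (zα k) V) ≋ δ γ k ⊙ V
    first γ k = derZ-mulZ-α-vacuum γ k (∂V≋0 γ)

    second-derivative : ∀ γ → derZ (zα γ) (derZ (zα γ) (mulZ (zα a) (mulZ (zα b) V))) ≋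
                              δ γ a ⊙ (δ γ b ⊙ (two ⊙ V))
    second-derivative γ = begin
      ∂γ (∂γ (mulZ (zα a) (mulZ (zα b) V)))
        ≈⟨ ∂γ.cong (derZ-mulZ-α γ a _) ⟩
      ∂γ (δ γ a ⊙ mulZ (zα b) V ⊕ mulZ (zα a) (∂γ (mulZ (zα b) V)))
        ≈⟨ ∂γ.cong (⊕-cong {f = δ γ a ⊙ mulZ (zα b) V} ≋-refl
                           (≋-trans (IsLinear.cong (mulZ-linear (zα a)) (first γ b))
                                    (IsLinear.⊙-homo (mulZ-linear (zα a)) (δ γ b) V))) ⟩
      ∂γ (δ γ a ⊙ mulZ (zα b) V ⊕ δ γ b ⊙ mulZ (zα a) V)
        ≈⟨ ∂γ.⊕-homo (δ γ a ⊙ mulZ (zα b) V) (δ γ b ⊙ mulZ (zα a) V) ⟩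
      ∂γ (δ γ a ⊙ mulZ (zα b) V) ⊕ ∂γ (δ γ b ⊙ mulZ (zα a) V)
        ≈⟨ ⊕-cong (∂γ.⊙-homo (δ γ a) (mulZ (zα b) V)) (∂γ.⊙-homo (δ γ b) (mulZ (zα a) V)) ⟩
      δ γ a ⊙ ∂γ (mulZ (zα b) V) ⊕ δ γ b ⊙ ∂γ (mulZ (zα a) V)
        ≈⟨ ⊕-cong (⊙-congˡ _ (first γ b)) (⊙-congˡ _ (first γ a)) ⟩
      δ γ a ⊙ (δ γ b ⊙ V) ⊕ δ γ b ⊙ (δ γ a ⊙ V)
        ≈⟨ (λ e S → solve 3 (λ x y v → x :* (y :* v) :+ y :* (x :* v)
                                       := x :* (y :* ((con 1 :+ con 1) :* v))) refl _ _ _) ⟩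
      δ γ a ⊙ (δ γ b ⊙ (two ⊙ V)) ∎
      where
      ∂γ : Elt → Elt
      ∂γ = derZ (zα γ)
      module ∂γ = IsLinear (derZ-linear (zα γ))

  ∂-linear : IsLinear ∂
  ∂-linear = ⊙-linear ½ (sumElt-linear λ β →
    ∘-linear (Θ-linear i β) (IsPolynomialOperator.linear (ωX⁻-polynomial β)))

  ∂-expansion : ∀ a (F : Fin p → Elt) →
    ∂ (a ⊙ sumElt (λ α → Θ (- i) α (F α))) ≋
    ½ ⊙ (a ⊙ ΣΣ (λ β α → Θ i β (Θ (- i) α (ωX⁻ β (F α)))))
  ∂-expansion a F =
    ⊙-congˡ ½ (≋-trans (sumElt-cong row)
                       (sumElt-⊙ a (λ β → sumElt (λ α → Θ i β (Θ (- i) α (ωX⁻ β (F α)))))))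
    where
    open ≋-Reasoning
    row : ∀ β → Θ i β (ωX⁻ β (a ⊙ sumElt (λ α → Θ (- i) α (F α)))) ≋
                a ⊙ sumElt (λ α → Θ i β (Θ (- i) α (ωX⁻ β (F α))))
    row β = begin
      L (a ⊙ sumElt (λ α → Θ (- i) α (F α)))
        ≈⟨ L.⊙-homo a _ ⟩
      a ⊙ L (sumElt (λ α → Θ (- i) α (F α)))
        ≈⟨ ⊙-congˡ a (L.sumElt-homo (λ α → Θ (- i) α (F α))) ⟩
      a ⊙ sumElt (λ α → L (Θ (- i) α (F α)))
        ≈⟨ ⊙-congˡ a (sumElt-cong λ α → IsLinear.cong (Θ-linear i β)
                                          (polynomial-Θ-comm (ωX⁻-polynomial β) (- i) α (F α))) ⟩
      a ⊙ sumElt (λ α → Θ i β (Θ (- i) α (ωX⁻ β (F α)))) ∎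
      where
      L : Elt → Elt
      L f = Θ i β (ωX⁻ β f)
      module L = IsLinear (∘-linear (Θ-linear i β) (IsPolynomialOperator.linear (ωX⁻-polynomial β)))

  module _ (two½≈1 : two * ½ ≈ 1#) where

    self-negating : ∀ {x} → x ≈ - x → x ≈ 0#
    self-negating {x} x≈-x = begin
      x                ≈⟨ sym (*-identityˡ x) ⟩
      1# * x           ≈⟨ *-congʳ (sym two½≈1) ⟩
      (two * ½) * x    ≈⟨ solve 2 (λ h x → ((con 1 :+ con 1) :* h) :* x := h :* (x :+ x)) refl ½ x ⟩
      ½ * (x + x)      ≈⟨ *-congˡ (trans (+-congˡ x≈-x) (-‿inverseʳ x)) ⟩
      ½ * 0#           ≈⟨ zeroʳ ½ ⟩
      0#               ∎
      where open ≈-Reasoning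

    ΣΣ-antisymmetric : ∀ (F : Fin p → Fin p → Elt) → (∀ j k → F j k ≋ ⊝ F k j) → ΣΣ F ≋ zeroE
    ΣΣ-antisymmetric F F-anti e S = self-negating (begin
      ΣΣ F e S                      ≈⟨ ΣΣ-cong F-anti e S ⟩
      ΣΣ (λ j k → ⊝ F k j) e S      ≈⟨ ΣΣ-⊝ (λ j k → F k j) e S ⟩
      - ΣΣ (λ j k → F k j) e S      ≈⟨ -‿cong (ΣΣ-transpose F e S) ⟨
      - ΣΣ F e S                    ∎)
      where open ≈-Reasoning

    ΣΣ-Θ-symmetric : ∀ t t′ (Z : Fin p → Fin p → Elt) → (∀ j k → Z j k ≋ Z k j) →
                     ΣΣ (λ β α → Θ t β (Θ t′ α (Z β α))) ≋
                     (t′ + - t) ⊙ ΣΣ (λ a b → ω₁∧ω₂ a b (Z a b))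
    ΣΣ-Θ-symmetric t t′ Z Z-sym = begin
      ΣΣ (λ β α → Θ t β (Θ t′ α (Z β α)))
        ≈⟨ ΣΣ-cong (λ β α → ⊕-cong (expand zero β α) (⊙-congˡ t (expand (suc zero) β α))) ⟩
      ΣΣ (λ β α → (A₁₁ β α ⊕ t′ ⊙ A₁₂ β α) ⊕ t ⊙ (A₂₁ β α ⊕ t′ ⊙ A₂₂ β α))
        ≈⟨ ≋-trans (ΣΣ-⊕⊙ t _ _) (⊕-cong (ΣΣ-⊕⊙ t′ A₁₁ A₁₂) (⊙-congˡ t (ΣΣ-⊕⊙ t′ A₂₁ A₂₂))) ⟩
      (ΣΣ A₁₁ ⊕ t′ ⊙ ΣΣ A₁₂) ⊕ t ⊙ (ΣΣ A₂₁ ⊕ t′ ⊙ ΣΣ A₂₂)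
        ≈⟨ ⊕-cong (⊕-cong (diagonal-vanishes zero) ≋-refl)
                  (⊙-congˡ t (⊕-cong mixed (⊙-congˡ t′ (diagonal-vanishes (suc zero))))) ⟩
      (zeroE ⊕ t′ ⊙ ΣΣ A₁₂) ⊕ t ⊙ (⊝ ΣΣ A₁₂ ⊕ t′ ⊙ zeroE)
        ≈⟨ (λ e S → collect (ΣΣ A₁₂ e S)) ⟩
      (t′ + - t) ⊙ ΣΣ A₁₂ ∎
      where
      open ≋-Reasoning
      A : Fin 2 → Fin 2 → Fin p → Fin p → Elt
      A μ ν β α = wedge (gen β μ) (wedge (gen α ν) (Z β α))
      A₁₁ A₁₂ A₂₁ A₂₂ : Fin p → Fin p → Elt
      A₁₁ = A zero zero
      A₁₂ = A zero (suc zero)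
      A₂₁ = A (suc zero) zero
      A₂₂ = A (suc zero) (suc zero)

      expand : ∀ μ β α → wedge (gen β μ) (Θ t′ α (Z β α)) ≋ A μ zero β α ⊕ t′ ⊙ A μ (suc zero) β α
      expand μ β α = IsLinear.⊕⊙-homo (wedge-linear (gen β μ)) t′
                       (wedge (gen α zero) (Z β α)) (wedge (gen α (suc zero)) (Z β α))

      swap : ∀ μ ν β α → A μ ν β α ≋ ⊝ A ν μ α β
      swap μ ν β α = ≋-trans (wedge-anticomm (gen β μ) (gen α ν) (Z β α))
        (⊝-cong (IsLinear.cong (wedge-linear _) (IsLinear.cong (wedge-linear _) (Z-sym β α))))

      diagonal-vanishes : ∀ μ → ΣΣ (A μ μ) ≋ zeroE
      diagonal-vanishes μ = ΣΣ-antisymmetric (A μ μ) (swap μ μ)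

      mixed : ΣΣ A₂₁ ≋ ⊝ ΣΣ A₁₂
      mixed = ≋-trans (ΣΣ-cong (swap (suc zero) zero))
                      (≋-trans (ΣΣ-⊝ (λ β α → A₁₂ α β)) (⊝-cong (≋-sym (ΣΣ-transpose A₁₂))))

      collect : ∀ x → (0# + t′ * x) + t * (- x + t′ * 0#) ≈ (t′ + - t) * x
      collect x =
        trans (+-cong (+-identityˡ _) (*-congˡ (trans (+-congˡ (zeroʳ t′)) (+-identityʳ _))))
        (trans (+-congˡ (trans (sym (-‿distribʳ-* t x)) (-‿distribˡ-* t x)))
               (sym (distribʳ x t′ (- t))))

  module KudlaMillson (ππ⁻¹≈1 : π * π⁻¹ ≈ 1#) (two½≈1 : two * ½ ≈ 1#) (i²≈-1 : i * i ≈ - 1#)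
                      (ii⁻¹≈1 : i * i⁻¹ ≈ 1#) (√2²≈2 : √2 * √2 ≈ two) where

    -- κ and KM are chosen so that φKM unfolds definitionally to (κ * κ) ⊙ ΣΣ KM.
    c₄ κ : Carrier
    c₄ = ½ * ½ * π⁻¹
    κ  = - (√2 * c₄)

    W : Fin p → Fin p → Elt
    W a b = ω₁∧ω₂ a b φ₀

    KM : Fin p → Fin p → Elt
    KM a b = mulZ (zα a) (mulZ (zα b) (W a b))

    trW C : Elt
    trW = sumElt (λ a → W a a)
    C   = ΣΣ (λ a b → ω₁∧ω₂ a b (mulZ (zα a) (mulZ (zα b) (mulQ φ₀))))

    W-constant : ∀ a b γ → derZ (zα γ) (W a b) ≋ zeroE
    W-constant a b γ =
      ≋-trans (polynomial-ω₁∧ω₂-comm (derZ-polynomial (zα γ)) a b φ₀)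
              (≋-trans (IsLinear.cong (ω₁∧ω₂-linear a b) (derZ-φ₀ (zα γ)))
                       (IsLinear.zero-homo (ω₁∧ω₂-linear a b)))

    Δ-φKM : Δ φKM ≋ (κ * κ) ⊙ (two ⊙ trW)
    Δ-φKM = begin
      Δ ((κ * κ) ⊙ ΣΣ KM)
        ≈⟨ Δ.⊙-homo (κ * κ) (ΣΣ KM) ⟩
      (κ * κ) ⊙ Δ (ΣΣ KM)
        ≈⟨ ⊙-congˡ _ (Δ.ΣΣ-homo KM) ⟩
      (κ * κ) ⊙ ΣΣ (λ a b → Δ (KM a b))
        ≈⟨ ⊙-congˡ _ (ΣΣ-cong λ a b → Δ-quadratic a b (W-constant a b)) ⟩
      (κ * κ) ⊙ ΣΣ (λ a b → δ a b ⊙ (two ⊙ W a b))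
        ≈⟨ ⊙-congˡ _ (ΣΣ-δ (λ a b → two ⊙ W a b)) ⟩
      (κ * κ) ⊙ sumElt (λ a → two ⊙ W a a)
        ≈⟨ ⊙-congˡ _ (sumElt-⊙ two (λ a → W a a)) ⟩
      (κ * κ) ⊙ (two ⊙ trW) ∎
      where
      open ≋-Reasoning
      module Δ = IsLinear Δ-linear

    mulQ-φKM : mulQ φKM ≋ (κ * κ) ⊙ C
    mulQ-φKM =
      ≋-trans (Q.⊙-homo (κ * κ) (ΣΣ KM)) (⊙-congˡ _ (≋-trans (Q.ΣΣ-homo KM) (ΣΣ-cong mulQ-KM)))
      where
      module Q = IsPolynomialOperator mulQ-polynomial
      mulQ-KM : ∀ a b → mulQ (KM a b) ≋ ω₁∧ω₂ a b (mulZ (zα a) (mulZ (zα b) (mulQ φ₀)))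
      mulQ-KM a b =
        ≋-trans (polynomial-ω₁∧ω₂-comm (∘-polynomial mulQ-polynomial
                                          (∘-polynomial (mulZ-polynomial (zα a)) (mulZ-polynomial (zα b))))
                                       a b φ₀)
                (IsLinear.cong (ω₁∧ω₂-linear a b)
                  (≋-trans (mulQ-mulZ (zα a) _)
                           (IsLinear.cong (mulZ-linear (zα a)) (mulQ-mulZ (zα b) φ₀))))

    w₀ : Elt
    w₀ = mulW i φ₀

    Z : Fin p → Fin p → Elt
    Z β α = (- (four * π)) ⊙ (δ β α ⊙ (two ⊙ φ₀)) ⊕ c₄ ⊙ mulZ (zα β) (mulZ (zα α) (mulQ φ₀))

    -i*i≈1 : (- i) * i ≈ 1#
    -i*i≈1 = trans (sym (-‿distribˡ-* i i)) (trans (-‿cong i²≈-1) (-‿involutive 1#))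

    ωX⁺-φ₀ : ∀ α → ωX⁺ α φ₀ ≋ c₄ ⊙ mulZ (zα α) w₀
    ωX⁺-φ₀ α = ≋-trans (ωX-combination i α φ₀)
      (≋-trans (⊕-cong (⊙-congˡ _ (≋-trans (∂α.cong (derW-φ₀ i)) ∂α.zero-homo)) ≋-refl)
               (≋-trans (⊕-cong (⊙-zeroʳ _) ≋-refl) (⊕-identityˡ _)))
      where module ∂α = IsLinear (derZ-linear (zα α))

    ∂̄-φ₀ : ∂̄ φ₀ ≋ (½ * c₄) ⊙ sumElt (λ α → Θ (- i) α (mulZ (zα α) w₀))
    ∂̄-φ₀ = begin
      ½ ⊙ sumElt (λ α → Θ (- i) α (ωX⁺ α φ₀))
        ≈⟨ ⊙-congˡ ½ (sumElt-cong λ α → ≋-trans (IsLinear.cong (Θ-linear (- i) α) (ωX⁺-φ₀ α))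
                                                (IsLinear.⊙-homo (Θ-linear (- i) α) c₄ (mulZ (zα α) w₀))) ⟩
      ½ ⊙ sumElt (λ α → c₄ ⊙ Θ (- i) α (mulZ (zα α) w₀))
        ≈⟨ ⊙-congˡ ½ (sumElt-⊙ c₄ (λ α → Θ (- i) α (mulZ (zα α) w₀))) ⟩
      ½ ⊙ (c₄ ⊙ sumElt (λ α → Θ (- i) α (mulZ (zα α) w₀)))
        ≈⟨ (λ e S → sym (*-assoc ½ c₄ _)) ⟩
      (½ * c₄) ⊙ sumElt (λ α → Θ (- i) α (mulZ (zα α) w₀)) ∎
      where open ≋-Reasoning

    ωX⁻-∂̄-φ₀ : ∀ β α → ωX⁻ β (mulZ (zα α) w₀) ≋ Z β α
    ωX⁻-∂̄-φ₀ β α = ≋-trans (ωX-combination (- i) β (mulZ (zα α) w₀))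
                           (⊕-cong (⊙-congˡ _ second-order) (⊙-congˡ c₄ (Mβ.cong multiplication)))
      where
      module Mα = IsLinear (mulZ-linear (zα α))
      module Mβ = IsLinear (mulZ-linear (zα β))
      module ∂β = IsLinear (derZ-linear (zα β))

      two⊙φ₀-constant : derZ (zα β) (two ⊙ φ₀) ≋ zeroE
      two⊙φ₀-constant = ≋-trans (∂β.⊙-homo two φ₀) (≋-trans (⊙-congˡ two (derZ-φ₀ _)) (⊙-zeroʳ two))

      second-order : derZ (zα β) (derW (- i) (mulZ (zα α) w₀)) ≋ δ β α ⊙ (two ⊙ φ₀)
      second-order =
        ≋-trans (∂β.cong (≋-trans (derW-mulZ-zα (- i) α w₀)
                                  (Mα.cong (≋-trans (derW-mulW-φ₀ (- i) i)
                                                    (λ e S → *-congʳ (+-congˡ -i*i≈1))))))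
                (derZ-mulZ-α-vacuum β α two⊙φ₀-constant)

      multiplication : mulW (- i) (mulZ (zα α) w₀) ≋ mulZ (zα α) (mulQ φ₀)
      multiplication = ≋-trans (mulW-mulZ (- i) (zα α) w₀) (Mα.cong (mulW-mulW (-‿inverseˡ i) -i*i≈1 φ₀))

    Z-symmetric : ∀ β α → Z β α ≋ Z α β
    Z-symmetric β α = ⊕-cong (⊙-congˡ _ (λ e S → *-congʳ (reflexive (δ-sym β α))))
                             (⊙-congˡ c₄ (mulZ-comm (zα β) (zα α) (mulQ φ₀)))

    ΣΣ-ω₁∧ω₂-Z : ΣΣ (λ a b → ω₁∧ω₂ a b (Z a b)) ≋ (- (four * π)) ⊙ (two ⊙ trW) ⊕ c₄ ⊙ C
    ΣΣ-ω₁∧ω₂-Z = begin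
      ΣΣ (λ a b → ω₁∧ω₂ a b (Z a b))
        ≈⟨ ΣΣ-cong (λ a b → ≋-trans (L.⊕⊙-homo a b c₄ (m ⊙ (δ a b ⊙ (two ⊙ φ₀))) (Y a b))
                                    (⊕-cong (scalars a b) ≋-refl)) ⟩
      ΣΣ (λ a b → m ⊙ (δ a b ⊙ (two ⊙ W a b)) ⊕ c₄ ⊙ ω₁∧ω₂ a b (Y a b))
        ≈⟨ ΣΣ-⊕⊙ c₄ (λ a b → m ⊙ (δ a b ⊙ (two ⊙ W a b))) (λ a b → ω₁∧ω₂ a b (Y a b)) ⟩
      ΣΣ (λ a b → m ⊙ (δ a b ⊙ (two ⊙ W a b))) ⊕ c₄ ⊙ C
        ≈⟨ ⊕-cong (≋-trans (ΣΣ-⊙ m _) (⊙-congˡ m (≋-trans (ΣΣ-δ (λ a b → two ⊙ W a b))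
                                                           (sumElt-⊙ two (λ a → W a a))))) ≋-refl ⟩
      m ⊙ (two ⊙ trW) ⊕ c₄ ⊙ C ∎
      where
      open ≋-Reasoning
      m : Carrier
      m = - (four * π)
      Y : Fin p → Fin p → Elt
      Y a b = mulZ (zα a) (mulZ (zα b) (mulQ φ₀))
      module L a b = IsLinear (ω₁∧ω₂-linear a b)
      scalars : ∀ a b → ω₁∧ω₂ a b (m ⊙ (δ a b ⊙ (two ⊙ φ₀))) ≋ m ⊙ (δ a b ⊙ (two ⊙ W a b))
      scalars a b = ≋-trans (L.⊙-homo a b m (δ a b ⊙ (two ⊙ φ₀)))
                            (⊙-congˡ m (≋-trans (L.⊙-homo a b (δ a b) (two ⊙ φ₀))
                                                (⊙-congˡ (δ a b) (L.⊙-homo a b two φ₀))))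

    ∂∂̄-φ₀ : ∂ (∂̄ φ₀) ≋ ½ ⊙ ((½ * c₄) ⊙ ((- i + - i) ⊙ ((- (four * π)) ⊙ (two ⊙ trW) ⊕ c₄ ⊙ C)))
    ∂∂̄-φ₀ = begin
      ∂ (∂̄ φ₀)
        ≈⟨ IsLinear.cong ∂-linear ∂̄-φ₀ ⟩
      ∂ ((½ * c₄) ⊙ sumElt (λ α → Θ (- i) α (mulZ (zα α) w₀)))
        ≈⟨ ∂-expansion (½ * c₄) (λ α → mulZ (zα α) w₀) ⟩
      ½ ⊙ ((½ * c₄) ⊙ ΣΣ (λ β α → Θ i β (Θ (- i) α (ωX⁻ β (mulZ (zα α) w₀)))))
        ≈⟨ ⊙-congˡ ½ (⊙-congˡ _ (ΣΣ-cong λ β α →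
             IsLinear.cong (Θ-linear i β) (IsLinear.cong (Θ-linear (- i) α) (ωX⁻-∂̄-φ₀ β α)))) ⟩
      ½ ⊙ ((½ * c₄) ⊙ ΣΣ (λ β α → Θ i β (Θ (- i) α (Z β α))))
        ≈⟨ ⊙-congˡ ½ (⊙-congˡ _ (ΣΣ-Θ-symmetric two½≈1 i (- i) Z Z-symmetric)) ⟩
      ½ ⊙ ((½ * c₄) ⊙ ((- i + - i) ⊙ ΣΣ (λ a b → ω₁∧ω₂ a b (Z a b))))
        ≈⟨ ⊙-congˡ ½ (⊙-congˡ _ (⊙-congˡ _ ΣΣ-ω₁∧ω₂-Z)) ⟩
      ½ ⊙ ((½ * c₄) ⊙ ((- i + - i) ⊙ ((- (four * π)) ⊙ (two ⊙ trW) ⊕ c₄ ⊙ C))) ∎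
      where open ≋-Reasoning

    K : Carrier
    K = ½ * π⁻¹ * i⁻¹

    κ²≈2c₄² : κ * κ ≈ two * (c₄ * c₄)
    κ²≈2c₄² = begin
      (- (√2 * c₄)) * (- (√2 * c₄))
        ≈⟨ -x*-y≈x*y (√2 * c₄) (√2 * c₄) ⟩
      (√2 * c₄) * (√2 * c₄)
        ≈⟨ solve 2 (λ r c → (r :* c) :* (r :* c) := (r :* r) :* (c :* c)) refl √2 c₄ ⟩
      (√2 * √2) * (c₄ * c₄)
        ≈⟨ *-congʳ √2²≈2 ⟩
      two * (c₄ * c₄) ∎
      where open ≈-Reasoning

    4πc₄≈1 : (four * π) * c₄ ≈ 1#
    4πc₄≈1 = begin
      (four * π) * c₄
        ≈⟨ solve 3 (λ h π π⁻¹ → (con 2 :* con 2 :* π) :* (h :* h :* π⁻¹)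
                                := (con 2 :* h) :* ((con 2 :* h) :* (π :* π⁻¹))) refl ½ π π⁻¹ ⟩
      (two * ½) * ((two * ½) * (π * π⁻¹))
        ≈⟨ trans (unit-cancelˡ two½≈1 _) (unit-cancelˡ two½≈1 _) ⟩
      π * π⁻¹
        ≈⟨ ππ⁻¹≈1 ⟩
      1# ∎
      where open ≈-Reasoning

    Ks≈-π⁻¹ : K * (- i + - i) ≈ - π⁻¹
    Ks≈-π⁻¹ = begin
      K * (- i + - i)
        ≈⟨ *-congˡ (-‿+-comm i i) ⟩
      K * - (i + i)
        ≈⟨ -‿distribʳ-* K (i + i) ⟨
      - (K * (i + i))
        ≈⟨ -‿cong (solve 4 (λ h π⁻¹ i i⁻¹ → h :* π⁻¹ :* i⁻¹ :* (i :+ i)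
                                           := (con 2 :* h) :* ((i :* i⁻¹) :* π⁻¹)) refl ½ π⁻¹ i i⁻¹) ⟩
      - ((two * ½) * ((i * i⁻¹) * π⁻¹))
        ≈⟨ -‿cong (trans (unit-cancelˡ two½≈1 _) (unit-cancelˡ ii⁻¹≈1 π⁻¹)) ⟩
      - π⁻¹ ∎
      where open ≈-Reasoning

    Δ-coefficient : (two * π) * (κ * κ) ≈ c₄
    Δ-coefficient = begin
      (two * π) * (κ * κ)
        ≈⟨ *-congˡ κ²≈2c₄² ⟩
      (two * π) * (two * (c₄ * c₄))
        ≈⟨ solve 2 (λ π c → (con 2 :* π) :* (con 2 :* (c :* c)) := ((con 2 :* con 2 :* π) :* c) :* c)
                   refl π c₄ ⟩
      ((four * π) * c₄) * c₄
        ≈⟨ unit-cancelˡ 4πc₄≈1 c₄ ⟩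
      c₄ ∎
      where open ≈-Reasoning

    mulQ-coefficient : (- (½ * ½ * ½ * π⁻¹)) * (κ * κ) ≈ - (c₄ * (c₄ * c₄))
    mulQ-coefficient = begin
      (- (½ * ½ * ½ * π⁻¹)) * (κ * κ)
        ≈⟨ -‿distribˡ-* _ _ ⟨
      - ((½ * ½ * ½ * π⁻¹) * (κ * κ))
        ≈⟨ -‿cong (*-congˡ κ²≈2c₄²) ⟩
      - ((½ * ½ * ½ * π⁻¹) * (two * (c₄ * c₄)))
        ≈⟨ -‿cong (solve 3 (λ h q c → (h :* h :* h :* q) :* (con 2 :* (c :* c))
                                      := (con 2 :* h) :* ((h :* h :* q) :* (c :* c))) refl ½ π⁻¹ c₄) ⟩
      - ((two * ½) * (c₄ * (c₄ * c₄)))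
        ≈⟨ -‿cong (unit-cancelˡ two½≈1 _) ⟩
      - (c₄ * (c₄ * c₄)) ∎
      where open ≈-Reasoning

    ∂∂̄-scalar : ∀ x → K * (½ * ((½ * c₄) * ((- i + - i) * x))) ≈ (- π⁻¹) * ((½ * ½ * c₄) * x)
    ∂∂̄-scalar x =
      trans (solve 5 (λ k h c s x → k :* (h :* ((h :* c) :* (s :* x))) := (k :* s) :* ((h :* h :* c) :* x))
                     refl K ½ c₄ (- i + - i) x)
            (*-congʳ Ks≈-π⁻¹)

    trW-coefficient : K * (½ * ((½ * c₄) * ((- i + - i) * (- (four * π))))) ≈ c₄
    trW-coefficient = begin
      K * (½ * ((½ * c₄) * ((- i + - i) * (- (four * π)))))
        ≈⟨ ∂∂̄-scalar (- (four * π)) ⟩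
      (- π⁻¹) * ((½ * ½ * c₄) * - (four * π))
        ≈⟨ trans (*-congˡ (sym (-‿distribʳ-* _ _))) (-x*-y≈x*y _ _) ⟩
      π⁻¹ * ((½ * ½ * c₄) * (four * π))
        ≈⟨ solve 4 (λ h q c f → q :* ((h :* h :* c) :* f) := (f :* c) :* (h :* h :* q)) refl ½ π⁻¹ c₄ (four * π) ⟩
      ((four * π) * c₄) * c₄
        ≈⟨ unit-cancelˡ 4πc₄≈1 c₄ ⟩
      c₄ ∎
      where open ≈-Reasoning

    C-coefficient : K * (½ * ((½ * c₄) * ((- i + - i) * c₄))) ≈ - (c₄ * (c₄ * c₄))
    C-coefficient = begin
      K * (½ * ((½ * c₄) * ((- i + - i) * c₄)))
        ≈⟨ ∂∂̄-scalar c₄ ⟩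
      (- π⁻¹) * ((½ * ½ * c₄) * c₄)
        ≈⟨ -‿distribˡ-* _ _ ⟨
      - (π⁻¹ * ((½ * ½ * c₄) * c₄))
        ≈⟨ -‿cong (solve 3 (λ h q c → q :* ((h :* h :* c) :* c) := (h :* h :* q) :* (c :* c)) refl ½ π⁻¹ c₄) ⟩
      - (c₄ * (c₄ * c₄)) ∎
      where open ≈-Reasoning

    ωL-φKM : ωL φKM ≋ c₄ ⊙ (two ⊙ trW) ⊕ (- (c₄ * (c₄ * c₄))) ⊙ C
    ωL-φKM = ≋-trans (⊕-cong (⊙-congˡ _ Δ-φKM) (⊙-congˡ _ mulQ-φKM))
                     (⊕-cong (⊙-merge Δ-coefficient (two ⊙ trW)) (⊙-merge mulQ-coefficient C))

    ⊝ddc-φ₀ : ⊝ ddc φ₀ ≋ c₄ ⊙ (two ⊙ trW) ⊕ (- (c₄ * (c₄ * c₄))) ⊙ C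
    ⊝ddc-φ₀ = begin
      ⊝ ((- K) ⊙ ∂ (∂̄ φ₀))
        ≈⟨ (λ e S → trans (-‿cong (sym (-‿distribˡ-* K _))) (-‿involutive _)) ⟩
      K ⊙ ∂ (∂̄ φ₀)
        ≈⟨ ⊙-congˡ K ∂∂̄-φ₀ ⟩
      K ⊙ (½ ⊙ ((½ * c₄) ⊙ (s ⊙ (m ⊙ (two ⊙ trW) ⊕ c₄ ⊙ C))))
        ≈⟨ (λ e S → distribute K ½ (½ * c₄) s m c₄ (two * trW e S) (C e S)) ⟩
      (K * (½ * ((½ * c₄) * (s * m)))) ⊙ (two ⊙ trW) ⊕ (K * (½ * ((½ * c₄) * (s * c₄)))) ⊙ C
        ≈⟨ ⊕-cong (⊙-congʳ trW-coefficient (two ⊙ trW)) (⊙-congʳ C-coefficient C) ⟩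
      c₄ ⊙ (two ⊙ trW) ⊕ (- (c₄ * (c₄ * c₄))) ⊙ C ∎
      where
      open ≋-Reasoning
      s m : Carrier
      s = - i + - i
      m = - (four * π)
      distribute : ∀ k h h′ s m c x y → k * (h * (h′ * (s * (m * x + c * y)))) ≈
                                        (k * (h * (h′ * (s * m)))) * x + (k * (h * (h′ * (s * c)))) * y
      distribute = solve 8 (λ k h h′ s m c x y → k :* (h :* (h′ :* (s :* (m :* x :+ c :* y))))
                             := (k :* (h :* (h′ :* (s :* m)))) :* x :+ (k :* (h :* (h′ :* (s :* c)))) :* y) refl

theorem4p4 : ∀ {c ℓ} (R : CommutativeRing c ℓ)
    (π π⁻¹ ½ i i⁻¹ √2 : CommutativeRing.Carrier R) →
    let open CommutativeRing R in
    π * π⁻¹ ≈ 1# →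
    (1# + 1#) * ½ ≈ 1# →
    i * i ≈ - 1# →
    i * i⁻¹ ≈ 1# →
    √2 * √2 ≈ 1# + 1# →
    (p : ℕ) →
    let open Fock R π π⁻¹ ½ i i⁻¹ √2 p in
    ωL φKM ≋ ⊝ ddc φ₀
theorem4p4 R π π⁻¹ ½ i i⁻¹ √2 ππ⁻¹≈1 two½≈1 i²≈-1 ii⁻¹≈1 √2²≈2 p =
  ≋-trans ωL-φKM (≋-sym ⊝ddc-φ₀)
  where
  open FockCalculus R π π⁻¹ ½ i i⁻¹ √2 p
  open KudlaMillson ππ⁻¹≈1 two½≈1 i²≈-1 ii⁻¹≈1 √2²≈2
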